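{- Fix an SLTL structure, an agent $a\in\mathit{Ag}$ and an SLTL formula $\varphi$. Let $\models$ be one of $\models^{\mathrm{step}},\models^{\mathrm{pobs}},\models^{\mathrm{public}},\models^{\mathrm{decr}}_Q,\models^{\mathrm{incr}}_Q$ (with $Q\subseteq P$), and let $\mathfrak O_a$ be, respectively, $\emptyset$, $P_a$, $P$, $Q\cap P_a$, $Q\cup P_a$. If $h_1,h_2\in(2^P)^+$ satisfy $h_1|_{\mathfrak O_a}=h_2|_{\mathfrak O_a}$, then for all $f_1,f_2\in(2^P)^\omega$ with $\mathit{first}(f_1)=\mathit{last}(h_1)$ and $\mathit{first}(f_2)=\mathit{last}(h_2)$: $(f_1,h_1)\models\langle a\rangle\varphi$ if and only if $(f_2,h_2)\models\langle a\rangle\varphi$.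
   Context: Fix finite sets $P$ (atomic propositions) and $\mathit{Ag}$ (agents). For a finite or infinite word $\varsigma$ over $2^P$ and $R\subseteq P$, $\varsigma|_R$ is obtained by intersecting every letter with $R$; $\mathit{first}(\varsigma)$ and $\mathit{last}(\varsigma)$ are the first and last letters; for $f=H_0H_1\cdots$, $f[i]=H_i$, $f[i..j]=H_i\cdots H_j$ (the empty word if $i>j$), and $f[j..]=H_jH_{j+1}\cdots$. A transition system is $\mathcal T=(S,\to,\mathit{Init},R,L)$ with $S$ finite, $\to\subseteq S\times S$ total, $\mathit{Init}\subseteq S$, $R$ a finite set of propositions and $L:S\to2^R$. For a path $\pi=s_0s_1\cdots$, $\mathit{trace}(\pi)=L(s_0)L(s_1)\cdots$; $\mathit{Traces}(\mathcal T,s)$ is the set of traces of infinite paths starting in $s$; for $P\supseteq R$, $\mathit{Traces}^P(\mathcal T,s)=\{\rho\in(2^P)^\omega:\rho|_R\in\mathit{Traces}(\mathcal T,s)\}$; for $h\in(2^P)^+$, $\mathit{Reach}(\mathcal T,h)$ is the set of states $s$ such that some finite path starting in $\mathit{Init}$ ends in $s$ and has trace $h|_R$. SLTL formulas: $\varphi::=\mathit{true}\mid p\mid\neg\varphi\mid\varphi_1\wedge\varphi_2\mid\bigcirc\varphi\mid\varphi_1\,\mathrm U\,\varphi_2\mid\langle a\rangle\varphi$ with $p\in P$, $a\in\mathit{Ag}$. An SLTL structure is $\mathfrak T=(\mathcal T_0,(\mathcal T_a)_{a\in\mathit{Ag}})$ where $\mathcal T_0=(S_0,\to_0,\{\mathit{init}_0\},P,L_0)$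 and $\mathcal T_a=(S_a,\to_a,\{\mathit{init}_a\},P_a,L_a)$ with $P_a\subseteq P$. Formulas are interpreted over future-history pairs $(f,h)\in(2^P)^\omega\times(2^P)^+$ with $\mathit{last}(h)=\mathit{first}(f)$: $(f,h)\models\mathit{true}$ always; $(f,h)\models p$ iff $p\in f[0]$; usual clauses for $\neg,\wedge$; $(f,h)\models\bigcirc\varphi$ iff $(f[1..],h\,f[1])\models\varphi$; $(f,h)\models\varphi_1\mathrm U\varphi_2$ iff there is $\ell\in\mathbb N$ with $(f[\ell..],h\,f[1..\ell])\models\varphi_2$ and $(f[j..],h\,f[1..j])\models\varphi_1$ for all $j<\ell$. Standpoint clause: $(f,h)\models\langle a\rangle\varphi$ iff there exist $h'\in(2^P)^+$, $t\in\mathit{Reach}(\mathcal T_a,h')$ and $f'\in\mathit{Traces}^P(\mathcal T_a,t)$ with $\mathit{last}(h')=\mathit{first}(f')$, $h|_{\mathfrak O}=h'|_{\mathfrak O}$ and $(f',h')\models'\varphi$, where: for $\models^{\mathrm{step}}$, $\mathfrak O=\emptyset$ and $\models'=\models^{\mathrm{step}}$; for $\models^{\mathrm{pobs}}$, $\mathfrak O=P_a$, $\models'=\models^{\mathrm{pobs}}$; for $\models^{\mathrm{public}}$, $\mathfrak O=P$, $\models'=\models^{\mathrm{public}}$; for $\models^{\mathrm{decr}}_Q$ ($Q\subseteq P$), $\mathfrak O=Q\cap P_a$ and $\models'=\models^{\mathrm{decr}}_{Q\cap P_a}$; for $\models^{\mathrm{incr}}_Q$, $\mathfrak O=Q\cup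 P_a$ and $\models'=\models^{\mathrm{incr}}_{Q\cup P_a}$ (in all other clauses $Q$ is unchanged). -}

module Defs where

open import Data.Nat using (ℕ; zero; suc; _+_; _<_)
open import Data.Fin using (Fin)
open import Data.Fin.Subset using (Subset; _∩_; _∪_; ⊥; ⊤; _∈_)
import Data.Unit
open import Data.List using (List; upTo)
import Data.List as List
open import Data.List.NonEmpty using (List⁺; toList; last; head; _⁺++_; _⁺∷ʳ_)
import Data.List.NonEmpty as List⁺
open import Data.List.Relation.Unary.Linked using (Linked)
open import Data.List.Relation.Binary.Pointwise using (Pointwise)
open import Data.Product using (Σ; ∃; _×_)
open import Relation.Binary.PropositionalEquality using (_≡_)
open import Relation.Nullary using (¬_)

-- Propositions P = Fin nP; a letter of 2^P is a Subset nP.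
Letter : ℕ → Set
Letter nP = Subset nP

InfWord : ℕ → Set
InfWord nP = ℕ → Letter nP

FinWord : ℕ → Set
FinWord nP = List⁺ (Letter nP)

restrict : ∀ {nP} → FinWord nP → Subset nP → FinWord nP
restrict h R = List⁺.map (_∩ R) h

suffix : ∀ {nP} → InfWord nP → ℕ → InfWord nP
suffix f j i = f (j + i)

-- f[1..ℓ] (empty if ℓ = 0)
segment : ∀ {nP} → InfWord nP → ℕ → List (Letter nP)
segment f ℓ = List.map (λ i → f (suc i)) (upTo ℓ)

record TS (nP : ℕ) : Set₁ where
  field
    nS    : ℕ
    trans : Fin nS → Fin nS → Set
    total : ∀ s → ∃ λ t → trans s t
    init  : Fin nS
    R     : Subset nP
    L     : Fin nS → Subset nP
    L⊆R   : ∀ s → L s ∩ R ≡ L s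

-- Traces^P(T, s): infinite words whose restriction to R is the trace of an
-- infinite path starting in s.
InTracesP : ∀ {nP} (T : TS nP) → Fin (TS.nS T) → InfWord nP → Set
InTracesP T s ρ =
  Σ (ℕ → Fin nS) λ π →
    (π 0 ≡ s) × (∀ i → trans (π i) (π (suc i))) × (∀ i → ρ i ∩ R ≡ L (π i))
  where open TS T

-- Reach(T, h): end states of finite paths from Init with trace h|_R.
InReach : ∀ {nP} (T : TS nP) → FinWord nP → Fin (TS.nS T) → Set
InReach T h t =
  Σ (List⁺ (Fin nS)) λ ps →
    (head ps ≡ init) × Linked trans (toList ps) × (last ps ≡ t)
    × Pointwise (λ H q → H ∩ R ≡ L q) (toList h) (toList ps)
  where open TS T

-- SLTL structure: T₀ over P (with Init = {init₀}) and one T_a per agent,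
-- with P_a ⊆ P.
record Structure (nP nAg : ℕ) : Set₁ where
  field
    T₀    : TS nP
    T₀-R  : TS.R T₀ ≡ ⊤
    Tag   : Fin nAg → TS nP

  Pa : Fin nAg → Subset nP
  Pa a = TS.R (Tag a)

data Form (nP nAg : ℕ) : Set where
  true : Form nP nAg
  prop : Fin nP → Form nP nAg
  ¬'   : Form nP nAg → Form nP nAg
  _∧'_ : Form nP nAg → Form nP nAg → Form nP nAg
  ○    : Form nP nAg → Form nP nAg
  _U_  : Form nP nAg → Form nP nAg → Form nP nAg
  ⟨_⟩_ : Fin nAg → Form nP nAg → Form nP nAg

data Mode (nP : ℕ) : Set where
  step pobs publ : Mode nP
  decr incr        : Subset nP → Mode nP

module _ {nP nAg : ℕ} (𝔗 : Structure nP nAg) where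
  open Structure 𝔗

  obs : Mode nP → Fin nAg → Subset nP
  obs step     a = ⊥
  obs pobs     a = Pa a
  obs publ     a = ⊤
  obs (decr Q) a = Q ∩ Pa a
  obs (incr Q) a = Q ∪ Pa a

  -- the semantics ⊨' used below a standpoint modality
  next : Mode nP → Fin nAg → Mode nP
  next step     a = step
  next pobs     a = pobs
  next publ     a = publ
  next (decr Q) a = decr (Q ∩ Pa a)
  next (incr Q) a = incr (Q ∪ Pa a)

  Sat : Mode nP → InfWord nP → FinWord nP → Form nP nAg → Set
  Sat m f h true      = Data.Unit.⊤
  Sat m f h (prop p)  = p ∈ f 0
  Sat m f h (¬' φ)    = ¬ Sat m f h φ
  Sat m f h (φ ∧' ψ)  = Sat m f h φ × Sat m f h ψ
  Sat m f h (○ φ)     = Sat m (suffix f 1) (h ⁺∷ʳ f 1) φ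
  Sat m f h (φ U ψ)   =
    Σ ℕ λ ℓ → Sat m (suffix f ℓ) (h ⁺++ segment f ℓ) ψ
             × (∀ j → j < ℓ → Sat m (suffix f j) (h ⁺++ segment f j) φ)
  Sat m f h (⟨ a ⟩ φ) =
    Σ (FinWord nP) λ h' → Σ (Fin (TS.nS (Tag a))) λ t → Σ (InfWord nP) λ f' →
      InReach (Tag a) h' t × InTracesP (Tag a) t f'
      × (last h' ≡ f' 0)
      × (restrict h (obs m a) ≡ restrict h' (obs m a))
      × Sat (next m a) f' h' φ

{-# OPTIONS --safe #-}
module Submission where

open import Defs
open import Data.Nat using (ℕ)
open import Data.Fin using (Fin)
open import Data.List.NonEmpty using (last)
open import Relation.Binary.PropositionalEquality using (_≡_; sym; trans)
open import Data.Product using (_,_)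
open import Function.Bundles using (_⇔_; mk⇔)

-- The standpoint clause reads the current history only through its
-- 𝔒_a-restriction, and the current future not at all.
Sat-⟨⟩-transfer : ∀ {nP nAg} (𝔗 : Structure nP nAg) (m : Mode nP) (a : Fin nAg)
                  (φ : Form nP nAg) {h₁ h₂ : FinWord nP} →
                  restrict h₁ (obs 𝔗 m a) ≡ restrict h₂ (obs 𝔗 m a) →
                  (f₁ f₂ : InfWord nP) → Sat 𝔗 m f₁ h₁ (⟨ a ⟩ φ) → Sat 𝔗 m f₂ h₂ (⟨ a ⟩ φ)
Sat-⟨⟩-transfer 𝔗 m a φ h₁≈h₂ _ _ (h' , t , f' , reach , traces , glue , h₁≈h' , sat) =
  h' , t , f' , reach , traces , glue , trans (sym h₁≈h₂) h₁≈h' , sat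

lemma3p3 : ∀ {nP nAg : ℕ} (𝔗 : Structure nP nAg) (a : Fin nAg) (φ : Form nP nAg)
    (m : Mode nP) (h₁ h₂ : FinWord nP) →
    restrict h₁ (obs 𝔗 m a) ≡ restrict h₂ (obs 𝔗 m a) →
    (f₁ f₂ : InfWord nP) → f₁ 0 ≡ last h₁ → f₂ 0 ≡ last h₂ →
    (Sat 𝔗 m f₁ h₁ (⟨ a ⟩ φ) ⇔ Sat 𝔗 m f₂ h₂ (⟨ a ⟩ φ))
lemma3p3 𝔗 a φ m h₁ h₂ h₁≈h₂ f₁ f₂ _ _ =
  mk⇔ (Sat-⟨⟩-transfer 𝔗 m a φ h₁≈h₂ f₁ f₂)
      (Sat-⟨⟩-transfer 𝔗 m a φ (sym h₁≈h₂) f₂ f₁)
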